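{- For every $n\ge 1$, the domination polynomial $D(B_n,x)$ of the book graph $B_n$ has no nonzero integer root.
   Context: For a finite simple graph $G$, the domination polynomial is $D(G,x)=\sum_i d(G,i)x^i$, where $d(G,i)$ is the number of dominating sets of size $i$ (a set $S$ of vertices is dominating if every vertex outside $S$ has a neighbor in $S$). The book graph $B_n$ is obtained by identifying a common edge in $n$ copies of the cycle $C_4$; its domination polynomial is $D(B_n,x)=(x^2+2x)^n(2x+1)+x^2(1+x)^{2n}-2x^n$. -}

module Defs where

open import Data.Nat using (ℕ)
open import Data.Integer using (ℤ; _+_; _-_; _*_; _^_; +_)

-- D(B_n, x) = (x^2 + 2x)^n (2x + 1) + x^2 (1 + x)^(2n) - 2 x^n,
-- the domination polynomial of the book graph B_n (as given in the context),
-- evaluated at an integer x.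
DB : ℕ → ℤ → ℤ
DB n x = ((x ^ 2 + (+ 2) * x) ^ n) * ((+ 2) * x + (+ 1))
       + (x ^ 2) * ((+ 1 + x) ^ (2 Data.Nat.* n))
       - (+ 2) * (x ^ n)

-- Modulo 1 + x we have x ≡ -1, and D(B_n, -1) = -3 (-1)^n for n ≥ 1; so an integer
-- root x satisfies 1 + x ∣ 3, i.e. x ∈ {0, 2, -2, -4}.  With a = x² + 2x one has
-- (1 + x)² = a + 1, hence whenever |x| ≤ a every term of D(B_n, x) is bounded below
-- by the matching multiple of aⁿ, giving D(B_n, x) ≥ aⁿ (a - 1) > 0 for x = 2, -4.
-- Finally -2 ≡ 1 (mod 3), and D(B_n, x) ≡ -1 (mod 3) whenever x ≡ 1 (mod 3).
module Submission where

open import Defs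
open import Data.Nat using (ℕ; _≥_)
open import Data.Integer using (ℤ; +_)
open import Relation.Binary.PropositionalEquality using (_≡_; _≢_)

open import Data.Nat as ℕ using (zero; suc; s≤s; z≤n)
import Data.Nat.Properties as ℕ
open import Data.Nat.Primality using (irreducible?)
import Data.Nat.Divisibility as ℕ
open import Data.Integer
  using (-[1+_]; _+_; _-_; _*_; -_; _^_; ∣_∣; _≤_; _<_; +≤+; +<+; -≤+; nonNegative; positive)
open import Data.Integer.Properties
  using (pos-*; abs-*; ∣-i∣≡∣i∣; *-zeroʳ; ^-*-assoc; ^-zeroˡ; _≤?_; _<?_; ≤-refl; ≤-trans; <-trans; <⇒≢;
         i≤i+j; neg-mono-≤; +-mono-≤; +-monoʳ-≤; +-monoˡ-<; *-monoˡ-≤-nonNeg; *-monoˡ-<-pos;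
         module ≤-Reasoning)
open import Data.Integer.Divisibility.Signed
  using (_∣_; divides; ∣⇒∣ᵤ; ∣ᵤ⇒∣; ∣m∣n⇒∣m+n; ∣m⇒∣m*n; ∣n⇒∣m*n; ∣m⇒∣-m)
open import Data.Integer.Tactic.RingSolver using (solve-∀)
open import Data.Sum using (_⊎_; inj₁; inj₂)
open import Function using (_$_)
open import Relation.Nullary using (¬_)
open import Relation.Nullary.Decidable using (from-yes; from-no)
open import Relation.Binary.PropositionalEquality using (refl; sym; trans; cong; subst; subst₂; module ≡-Reasoning)

pos-^ : ∀ m n → + (m ℕ.^ n) ≡ (+ m) ^ n
pos-^ m zero    = refl
pos-^ m (suc n) = trans (pos-* m (m ℕ.^ n)) (cong (+ m *_) (pos-^ m n))

abs-^ : ∀ i n → ∣ i ^ n ∣ ≡ ∣ i ∣ ℕ.^ n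
abs-^ i zero    = refl
abs-^ i (suc n) = trans (abs-* i (i ^ n)) (cong (∣ i ∣ ℕ.*_) (abs-^ i n))

i≤+∣i∣ : ∀ i → i ≤ + ∣ i ∣
i≤+∣i∣ (+ n)    = ≤-refl
i≤+∣i∣ -[1+ n ] = -≤+

0≤i^2 : ∀ i → + 0 ≤ i ^ 2
0≤i^2 (+ n)    = subst (+ 0 ≤_) (pos-^ n 2) (+≤+ z≤n)
0≤i^2 -[1+ n ] = +≤+ z≤n

0<i⇒0<i^n : ∀ n {i} → + 0 < i → + 0 < i ^ n
0<i⇒0<i^n n {+ suc m} _ = subst (+ 0 <_) (pos-^ (suc m) n) (+<+ (ℕ.m^n>0 (suc m) n))
0<i⇒0<i^n n {+ zero} (+<+ ())

^-monoˡ-≤-nonNeg : ∀ n {i j} → + 0 ≤ i → i ≤ j → i ^ n ≤ j ^ n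
^-monoˡ-≤-nonNeg n {+ a} {+ b} _ (+≤+ a≤b) =
  subst₂ _≤_ (pos-^ a n) (pos-^ b n) (+≤+ (ℕ.^-monoˡ-≤ n a≤b))

∣i∣≤j⇒i^n≤j^n : ∀ n {i j} → + ∣ i ∣ ≤ j → i ^ n ≤ j ^ n
∣i∣≤j⇒i^n≤j^n n {i} {j} ∣i∣≤j = begin
  i ^ n           ≤⟨ i≤+∣i∣ (i ^ n) ⟩
  + ∣ i ^ n ∣     ≡⟨ cong +_ (abs-^ i n) ⟩
  + (∣ i ∣ ℕ.^ n) ≡⟨ pos-^ ∣ i ∣ n ⟩
  (+ ∣ i ∣) ^ n   ≤⟨ ^-monoˡ-≤-nonNeg n (+≤+ z≤n) ∣i∣≤j ⟩
  j ^ n           ∎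
  where open ≤-Reasoning

infix 4 _≡_mod_
record _≡_mod_ (a b m : ℤ) : Set where
  constructor mod-divides
  field m∣a-b : m ∣ a - b

≡-mod-refl : ∀ {m} a → a ≡ a mod m
≡-mod-refl {m} a = mod-divides (divides (+ 0) (a-a≡0*m a m))
  where
  a-a≡0*m : ∀ a m → a - a ≡ + 0 * m
  a-a≡0*m = solve-∀

≡-mod-trans : ∀ {m a b c} → a ≡ b mod m → b ≡ c mod m → a ≡ c mod m
≡-mod-trans {a = a} {b} {c} (mod-divides m∣a-b) (mod-divides m∣b-c) = mod-divides $
  subst (_ ∣_) (split a b c) (∣m∣n⇒∣m+n m∣a-b m∣b-c)
  where
  split : ∀ a b c → (a - b) + (b - c) ≡ a - c
  split = solve-∀

+-cong-mod : ∀ {m a b c d} → a ≡ b mod m → c ≡ d mod m → a + c ≡ b + d mod m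
+-cong-mod {a = a} {b} {c} {d} (mod-divides m∣a-b) (mod-divides m∣c-d) = mod-divides $
  subst (_ ∣_) (split a b c d) (∣m∣n⇒∣m+n m∣a-b m∣c-d)
  where
  split : ∀ a b c d → (a - b) + (c - d) ≡ (a + c) - (b + d)
  split = solve-∀

*-cong-mod : ∀ {m a b c d} → a ≡ b mod m → c ≡ d mod m → a * c ≡ b * d mod m
*-cong-mod {a = a} {b} {c} {d} (mod-divides m∣a-b) (mod-divides m∣c-d) = mod-divides $
  subst (_ ∣_) (split a b c d) (∣m∣n⇒∣m+n (∣m⇒∣m*n c m∣a-b) (∣n⇒∣m*n b m∣c-d))
  where
  split : ∀ a b c d → (a - b) * c + b * (c - d) ≡ a * c - b * d
  split = solve-∀

neg-cong-mod : ∀ {m a b} → a ≡ b mod m → - a ≡ - b mod m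
neg-cong-mod {a = a} {b} (mod-divides m∣a-b) = mod-divides $
  subst (_ ∣_) (split a b) (∣m⇒∣-m m∣a-b)
  where
  split : ∀ a b → - (a - b) ≡ - a - - b
  split = solve-∀

≡⇒≡-mod : ∀ {m a b} → a ≡ b → a ≡ b mod m
≡⇒≡-mod {a = a} refl = ≡-mod-refl a

^-cong-mod : ∀ {m a b} n → a ≡ b mod m → a ^ n ≡ b ^ n mod m
^-cong-mod zero    _   = ≡-mod-refl (+ 1)
^-cong-mod (suc n) a≡b = *-cong-mod a≡b (^-cong-mod n a≡b)

DB-cong-mod : ∀ {m x y} n → x ≡ y mod m → DB n x ≡ DB n y mod m
DB-cong-mod {m} {x} {y} n x≡y =
  +-cong-mod (+-cong-mod (*-cong-mod (^-cong-mod n x²+2x) 2x+1) (*-cong-mod x² (^-cong-mod (2 ℕ.* n) 1+x)))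
             (neg-cong-mod (*-cong-mod (≡-mod-refl (+ 2)) (^-cong-mod n x≡y)))
  where
  x² : x ^ 2 ≡ y ^ 2 mod m
  x² = ^-cong-mod 2 x≡y
  2x : + 2 * x ≡ + 2 * y mod m
  2x = *-cong-mod (≡-mod-refl (+ 2)) x≡y
  x²+2x : x ^ 2 + + 2 * x ≡ y ^ 2 + + 2 * y mod m
  x²+2x = +-cong-mod x² 2x
  2x+1 : + 2 * x + + 1 ≡ + 2 * y + + 1 mod m
  2x+1 = +-cong-mod 2x (≡-mod-refl (+ 1))
  1+x : + 1 + x ≡ + 1 + y mod m
  1+x = +-cong-mod (≡-mod-refl (+ 1)) x≡y

-- At x = -1 both x ^ 2 + 2 x and 2 x + 1 equal -1, while 1 + x = 0.
DB-at-minus-one : ∀ n → DB (suc n) (- + 1) ≡ - (+ 3 * (- + 1) ^ suc n)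
DB-at-minus-one n = identity ((- + 1) ^ suc n)
  where
  identity : ∀ s → s * - + 1 + + 1 * + 0 - + 2 * s ≡ - (+ 3 * s)
  identity = solve-∀

∣DB[-1]∣≡3 : ∀ n → ∣ DB (suc n) (- + 1) ∣ ≡ 3
∣DB[-1]∣≡3 n = begin
  ∣ DB (suc n) (- + 1) ∣       ≡⟨ cong ∣_∣ (DB-at-minus-one n) ⟩
  ∣ - (+ 3 * (- + 1) ^ suc n) ∣ ≡⟨ ∣-i∣≡∣i∣ (+ 3 * (- + 1) ^ suc n) ⟩
  ∣ + 3 * (- + 1) ^ suc n ∣     ≡⟨ abs-* (+ 3) ((- + 1) ^ suc n) ⟩
  3 ℕ.* ∣ (- + 1) ^ suc n ∣     ≡⟨ cong (3 ℕ.*_) (abs-^ (- + 1) (suc n)) ⟩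
  3 ℕ.* 1 ℕ.^ suc n             ≡⟨ cong (3 ℕ.*_) (ℕ.^-zeroˡ (suc n)) ⟩
  3                             ∎
  where open ≡-Reasoning

x≡-1-mod-1+x : ∀ x → x ≡ - + 1 mod (+ 1 + x)
x≡-1-mod-1+x x = mod-divides (divides (+ 1) (x-[-1]≡1*[1+x] x))
  where
  x-[-1]≡1*[1+x] : ∀ x → x - - + 1 ≡ + 1 * (+ 1 + x)
  x-[-1]≡1*[1+x] = solve-∀

root⇒1+x∣DB[-1] : ∀ n x → DB n x ≡ + 0 → + 1 + x ∣ DB n (- + 1)
root⇒1+x∣DB[-1] n x DBx≡0 = subst (+ 1 + x ∣_) (-[0-d]≡d (DB n (- + 1))) (∣m⇒∣-m 1+x∣0-DB[-1])
  where
  -[0-d]≡d : ∀ d → - (+ 0 - d) ≡ d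
  -[0-d]≡d = solve-∀
  1+x∣0-DB[-1] : + 1 + x ∣ + 0 - DB n (- + 1)
  1+x∣0-DB[-1] = subst (λ d → + 1 + x ∣ d - DB n (- + 1)) DBx≡0
                       (_≡_mod_.m∣a-b (DB-cong-mod n (x≡-1-mod-1+x x)))

root⇒1+x∣3 : ∀ n x → n ≥ 1 → DB n x ≡ + 0 → + 1 + x ∣ + 3
root⇒1+x∣3 (suc n) x _ DBx≡0 =
  ∣ᵤ⇒∣ {i = + 3} (subst (∣ + 1 + x ∣ ℕ.∣_) (∣DB[-1]∣≡3 n)
                        (∣⇒∣ᵤ (root⇒1+x∣DB[-1] (suc n) x DBx≡0)))

1+x∣3⇒x∈⟨0,2,-2,-4⟩ : ∀ x → + 1 + x ∣ + 3 → x ≡ + 0 ⊎ x ≡ + 2 ⊎ x ≡ - + 2 ⊎ x ≡ - + 4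
1+x∣3⇒x∈⟨0,2,-2,-4⟩ x 1+x∣3 = by-cases x (from-yes (irreducible? 3) (∣⇒∣ᵤ 1+x∣3))
  where
  by-cases : ∀ x → ∣ + 1 + x ∣ ≡ 1 ⊎ ∣ + 1 + x ∣ ≡ 3 → x ≡ + 0 ⊎ x ≡ + 2 ⊎ x ≡ - + 2 ⊎ x ≡ - + 4
  by-cases (+ 0)                             _ = inj₁ refl
  by-cases (+ 2)                             _ = inj₂ (inj₁ refl)
  by-cases -[1+ 1 ]                          _ = inj₂ (inj₂ (inj₁ refl))
  by-cases -[1+ 3 ]                          _ = inj₂ (inj₂ (inj₂ refl))
  by-cases (+ 1)                             (inj₁ ())
  by-cases (+ 1)                             (inj₂ ())
  by-cases (+ suc (suc (suc _)))             (inj₁ ())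
  by-cases (+ suc (suc (suc _)))             (inj₂ ())
  by-cases -[1+ 0 ]                          (inj₁ ())
  by-cases -[1+ 0 ]                          (inj₂ ())
  by-cases -[1+ 2 ]                          (inj₁ ())
  by-cases -[1+ 2 ]                          (inj₂ ())
  by-cases -[1+ suc (suc (suc (suc _))) ]    (inj₁ ())
  by-cases -[1+ suc (suc (suc (suc _))) ]    (inj₂ ())

DB-lowerBound : ∀ n x → let a = x ^ 2 + + 2 * x in + ∣ x ∣ ≤ a → a ^ n * (a - + 1) ≤ DB n x
DB-lowerBound n x ∣x∣≤a = begin
  a ^ n * (a - + 1)                                      ≡⟨ expand (a ^ n) x (x ^ 2) ⟩
  a ^ n * (+ 2 * x + + 1) + x ^ 2 * a ^ n - + 2 * a ^ n
    ≤⟨ +-mono-≤ (+-monoʳ-≤ (a ^ n * (+ 2 * x + + 1))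
                             (*-monoˡ-≤-nonNeg (x ^ 2) ⦃ nonNegative (0≤i^2 x) ⦄ aⁿ≤[1+x]²ⁿ))
                (neg-mono-≤ (*-monoˡ-≤-nonNeg (+ 2) (∣i∣≤j⇒i^n≤j^n n ∣x∣≤a))) ⟩
  DB n x                                                 ∎
  where
  open ≤-Reasoning
  a = x ^ 2 + + 2 * x
  expand : ∀ p x x² → p * (x² + + 2 * x - + 1) ≡ p * (+ 2 * x + + 1) + x² * p - + 2 * p
  expand = solve-∀
  -- Squares are written out since the ring solver does not recognise ℤ's _^_.
  a+1≡[1+x]² : ∀ y → y * (y * + 1) + + 2 * y + + 1 ≡ (+ 1 + y) * ((+ 1 + y) * + 1)
  a+1≡[1+x]² = solve-∀
  aⁿ≤[1+x]²ⁿ : a ^ n ≤ (+ 1 + x) ^ (2 ℕ.* n)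
  aⁿ≤[1+x]²ⁿ = begin
    a ^ n                 ≤⟨ ^-monoˡ-≤-nonNeg n (≤-trans (+≤+ z≤n) ∣x∣≤a) (i≤i+j a (+ 1)) ⟩
    (a + + 1) ^ n         ≡⟨ cong (_^ n) (a+1≡[1+x]² x) ⟩
    ((+ 1 + x) ^ 2) ^ n   ≡⟨ ^-*-assoc (+ 1 + x) 2 n ⟩
    (+ 1 + x) ^ (2 ℕ.* n) ∎

DB-positive : ∀ n x → let a = x ^ 2 + + 2 * x in + ∣ x ∣ ≤ a → + 1 < a → + 0 < DB n x
DB-positive n x ∣x∣≤a 1<a = begin-strict
  + 0               ≡⟨ sym (*-zeroʳ (a ^ n)) ⟩
  a ^ n * + 0       <⟨ *-monoˡ-<-pos (a ^ n) ⦃ positive (0<i⇒0<i^n n (<-trans (+<+ (s≤s z≤n)) 1<a)) ⦄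
                                     (+-monoˡ-< (- + 1) 1<a) ⟩
  a ^ n * (a - + 1) ≤⟨ DB-lowerBound n x ∣x∣≤a ⟩
  DB n x            ∎
  where
  open ≤-Reasoning
  a = x ^ 2 + + 2 * x

DB≡-1-mod-3 : ∀ n x → x ≡ + 1 mod + 3 → DB n x ≡ - + 1 mod + 3
DB≡-1-mod-3 n x x≡1 = ≡-mod-trans (DB-cong-mod n x≡1) DB[1]≡-1
  where
  p*3-0≡p*3 : ∀ p → p * + 3 - + 0 ≡ p * + 3
  p*3-0≡p*3 = solve-∀
  3ⁿ*3≡0 : (+ 3) ^ n * + 3 ≡ + 0 mod + 3
  3ⁿ*3≡0 = mod-divides (divides ((+ 3) ^ n) (p*3-0≡p*3 ((+ 3) ^ n)))
  4ⁿ≡1 : (+ 2) ^ (2 ℕ.* n) ≡ + 1 mod + 3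
  4ⁿ≡1 = ≡-mod-trans (≡⇒≡-mod (sym (^-*-assoc (+ 2) 2 n)))
           (≡-mod-trans (^-cong-mod n (mod-divides (divides (+ 1) refl))) (≡⇒≡-mod (^-zeroˡ n)))
  DB[1]≡-1 : DB n (+ 1) ≡ + 0 + + 1 * + 1 - + 2 * + 1 mod + 3
  DB[1]≡-1 = +-cong-mod (+-cong-mod 3ⁿ*3≡0 (*-cong-mod (≡-mod-refl (+ 1)) 4ⁿ≡1))
                        (neg-cong-mod (*-cong-mod (≡-mod-refl (+ 2)) (≡⇒≡-mod (^-zeroˡ n))))

x≡1-mod-3⇒DB≢0 : ∀ n x → x ≡ + 1 mod + 3 → DB n x ≢ + 0
x≡1-mod-3⇒DB≢0 n x x≡1 DBx≡0 = 3∤1 (_≡_mod_.m∣a-b 0≡-1)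
  where
  0≡-1 : + 0 ≡ - + 1 mod + 3
  0≡-1 = subst (_≡ - + 1 mod + 3) DBx≡0 (DB≡-1-mod-3 n x x≡1)
  3∤1 : ¬ (+ 3 ∣ + 1)
  3∤1 3∣1 = from-no (3 ℕ.∣? 1) (∣⇒∣ᵤ 3∣1)

mainTheorem8 : (n : ℕ) → n ≥ 1 → (x : ℤ) → x ≢ + 0 → DB n x ≢ + 0
mainTheorem8 n n≥1 x x≢0 DBx≡0 with 1+x∣3⇒x∈⟨0,2,-2,-4⟩ x (root⇒1+x∣3 n x n≥1 DBx≡0)
... | inj₁ x≡0 = x≢0 x≡0
... | inj₂ (inj₁ refl) =
  <⇒≢ (DB-positive n (+ 2) (from-yes (+ 2 ≤? + 8)) (from-yes (+ 1 <? + 8))) (sym DBx≡0)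
... | inj₂ (inj₂ (inj₁ refl)) =
  x≡1-mod-3⇒DB≢0 n (- + 2) (mod-divides (divides (- + 1) refl)) DBx≡0
... | inj₂ (inj₂ (inj₂ refl)) =
  <⇒≢ (DB-positive n (- + 4) (from-yes (+ 4 ≤? + 8)) (from-yes (+ 1 <? + 8))) (sym DBx≡0)
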